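{- Let $\ell\in\{2,3\}$ and let $G\subseteq\Delta_2(\mathbb{F}_\ell)$ be a subgroup with $\operatorname{pr}_i(G)=\operatorname{GL}_2(\mathbb{F}_\ell)$ for each $i\in\{1,2\}$. Then $G=\Delta_2(\mathbb{F}_\ell)$ if and only if there exists $(g_1,g_2)\in G$ with $(\dim_1g_1,\dim_1g_2)\in\{(0,1),(1,0),(1,2),(2,1)\}$ when $\ell=2$, and $(\dim_1g_1,\dim_1g_2)\in\{(1,2),(2,1)\}$ when $\ell=3$.
   Context: $\Delta_2(\mathbb{F}_\ell)=\{(g_1,g_2)\in\operatorname{GL}_2(\mathbb{F}_\ell)^2:\det g_1=\det g_2\}$, $\operatorname{pr}_i$ is projection to the $i$-th factor, and for $g\in\operatorname{GL}_2(\mathbb{F}_\ell)$, $\dim_1g=\dim_{\mathbb{F}_\ell}\ker(g-I)$. -}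

module Defs where

open import Data.Nat using (ℕ; zero; suc; NonZero)
import Data.Nat as N
open import Data.Nat.DivMod using (_mod_)
open import Data.Fin using (Fin; toℕ)
import Data.Fin as F
open import Data.Vec using (Vec; []; _∷_)
open import Data.Vec.Relation.Unary.All using (All)
open import Data.Product using (Σ; _×_; _,_)
open import Data.Sum using (_⊎_)
open import Relation.Binary.PropositionalEquality using (_≡_)
open import Relation.Nullary using (¬_)

-- The prime field 𝔽_ℓ, modelled as Fin ℓ with arithmetic mod ℓ
-- (a field exactly when ℓ is prime; the theorem only uses ℓ ∈ {2,3}).
module Field (ℓ : ℕ) .{{_ : NonZero ℓ}} where

  𝔽 : Set
  𝔽 = Fin ℓ

  0F 1F : 𝔽
  0F = 0 mod ℓ
  1F = 1 mod ℓ

  _+F_ _*F_ _-F_ : 𝔽 → 𝔽 → 𝔽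
  a +F b = (toℕ a N.+ toℕ b) mod ℓ
  a *F b = (toℕ a N.* toℕ b) mod ℓ
  a -F b = (toℕ a N.+ (ℓ N.∸ toℕ b)) mod ℓ

  record V2 : Set where
    constructor vec
    field
      x y : 𝔽

  0V : V2
  0V = vec 0F 0F

  _+V_ : V2 → V2 → V2
  vec a b +V vec c d = vec (a +F c) (b +F d)

  _·V_ : 𝔽 → V2 → V2
  c ·V vec a b = vec (c *F a) (c *F b)

  record M2 : Set where
    constructor mat
    field
      a b c d : 𝔽

  I2 : M2
  I2 = mat 1F 0F 0F 1F

  _*M_ : M2 → M2 → M2
  mat a b c d *M mat a' b' c' d' =
    mat ((a *F a') +F (b *F c')) ((a *F b') +F (b *F d'))
        ((c *F a') +F (d *F c')) ((c *F b') +F (d *F d'))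

  _-M_ : M2 → M2 → M2
  mat a b c d -M mat a' b' c' d' = mat (a -F a') (b -F b') (c -F c') (d -F d')

  det : M2 → 𝔽
  det (mat a b c d) = (a *F d) -F (b *F c)

  apply : M2 → V2 → V2
  apply (mat a b c d) (vec x y) = vec ((a *F x) +F (b *F y)) ((c *F x) +F (d *F y))

  InGL2 : M2 → Set
  InGL2 g = ¬ (det g ≡ 0F)

  lincomb : ∀ {n} → Vec 𝔽 n → Vec V2 n → V2
  lincomb [] [] = 0V
  lincomb (c ∷ cs) (v ∷ vs) = (c ·V v) +V lincomb cs vs

  LinIndep : ∀ {n} → Vec V2 n → Set
  LinIndep {n} vs = (cs : Vec 𝔽 n) → lincomb cs vs ≡ 0V → All (_≡ 0F) cs

  Ker : M2 → V2 → Set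
  Ker A v = apply A v ≡ 0V

  IsKerBasis : ∀ {n} → M2 → Vec V2 n → Set
  IsKerBasis {n} A vs =
    All (Ker A) vs × LinIndep vs
    × ((w : V2) → Ker A w → Σ (Vec 𝔽 n) (λ cs → lincomb cs vs ≡ w))

  DimKer : M2 → ℕ → Set
  DimKer A n = Σ (Vec V2 n) (IsKerBasis A)

  Dim₁ : M2 → ℕ → Set
  Dim₁ g n = DimKer (g -M I2) n

  M2² : Set
  M2² = M2 × M2

  _*²_ : M2² → M2² → M2²
  (g₁ , g₂) *² (h₁ , h₂) = (g₁ *M h₁) , (g₂ *M h₂)

  InΔ2 : M2² → Set
  InΔ2 (g₁ , g₂) = InGL2 g₁ × InGL2 g₂ × det g₁ ≡ det g₂

  record IsSubgroupΔ2 (G : M2² → Set) : Set where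
    field
      ⊆Δ2   : ∀ g → G g → InΔ2 g
      one   : G (I2 , I2)
      mul   : ∀ g h → G g → G h → G (g *² h)
      inv   : ∀ g → G g → Σ M2² (λ h → G h × (g *² h ≡ (I2 , I2)) × (h *² g ≡ (I2 , I2)))

  Pr1Surj Pr2Surj : (M2² → Set) → Set
  Pr1Surj G = (g : M2) → InGL2 g → Σ M2 (λ h → G (g , h))
  Pr2Surj G = (g : M2) → InGL2 g → Σ M2 (λ h → G (h , g))

  -- G = Δ₂(𝔽_ℓ) (as sets; G ⊆ Δ₂ is part of the subgroup hypothesis)
  EqualsΔ2 : (M2² → Set) → Set
  EqualsΔ2 G = (g : M2²) → InΔ2 g → G g

Allowed : ℕ → ℕ → ℕ → Set
Allowed ℓ d₁ d₂ =
  (ℓ ≡ 2 × ((d₁ ≡ 0 × d₂ ≡ 1) ⊎ (d₁ ≡ 1 × d₂ ≡ 0) ⊎ (d₁ ≡ 1 × d₂ ≡ 2) ⊎ (d₁ ≡ 2 × d₂ ≡ 1)))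
  ⊎ (ℓ ≡ 3 × ((d₁ ≡ 1 × d₂ ≡ 2) ⊎ (d₁ ≡ 2 × d₂ ≡ 1)))

-- Let N = {h | (1 , h) ∈ G}. As pr₂(G) = GL₂, N is normalised by GL₂, and as
-- pr₁(G) = GL₂, G = Δ₂ as soon as SL₂ ⊆ N. For ℓ ∈ {2,3}, the transvection τ is
-- a product of at most two conjugates of any h ∈ GL₂ with dim₁ h = 1, and every
-- element of SL₂ is a product of conjugates of τ; both facts, like the linear
-- algebra of dim₁, are checked by exhaustive search over 𝔽_ℓ. An element
-- of G with dimensions (2,1) is (1 , h) with dim₁ h = 1, so h ∈ N. For ℓ = 2 an
-- element with dimensions (0,1) cubes to one with dimensions (2,1), because in
-- GL₂(𝔽₂) ≅ S₃ the fixed-point-free elements are the 3-cycles and those with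
-- dim₁ = 1 the transpositions. Swapping the factors handles (1,2) and (1,0);
-- conversely (1 , τ) ∈ Δ₂ has dimensions (2,1).
module Submission where

open import Defs
open import Data.Nat using (ℕ; NonZero; zero; suc; _∸_)
import Data.Fin as F
open import Data.Fin.Properties using (any?)
open import Data.Product using (Σ; ∃; _×_; _,_; proj₁; proj₂; swap)
open import Data.Sum using (_⊎_; inj₁; inj₂)
open import Data.List using (List; []; _∷_; map; concatMap; filter; allFin)
open import Data.List.Relation.Unary.All using ([]; _∷_) renaming (All to AllL)
open import Data.List.Relation.Unary.Any using (Any; satisfied)
import Data.List.Relation.Unary.All as AllL
import Data.List.Relation.Unary.Any as Any
open import Data.Vec using (Vec; []; _∷_)
import Data.Vec.Relation.Unary.All as AllV
open import Function using (_∘_)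
open import Function.Bundles using (_⇔_; mk⇔)
open import Relation.Binary.Definitions using (DecidableEquality)
open import Relation.Binary.PropositionalEquality using (_≡_; refl; sym; trans; cong; cong₂; subst)
open import Relation.Nullary using (Dec)
open import Relation.Nullary.Decidable using (map′; ¬?; _×-dec_; _→-dec_; decidable-stable; True; toWitness; from-yes)
open import Relation.Unary using (Decidable)

Searchable : Set → Set₁
Searchable A = {P : A → Set} → Decidable P → Dec (∃ P)

Exhaustible : Set → Set₁
Exhaustible A = {P : A → Set} → Decidable P → Dec (∀ x → P x)

searchable⇒exhaustible : ∀ {A} → Searchable A → Exhaustible A
searchable⇒exhaustible ∃? P? =
  map′ (λ ∄¬P x → decidable-stable (P? x) (λ ¬Px → ∄¬P (x , ¬Px)))
       (λ ∀P (x , ¬Px) → ¬Px (∀P x))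
       (¬? (∃? (¬? ∘ P?)))

searchable-Vec : ∀ {A} → Searchable A → ∀ n → Searchable (Vec A n)
searchable-Vec ∃? zero    P? = map′ ([] ,_) (λ { ([] , p) → p }) (P? [])
searchable-Vec ∃? (suc n) P? =
  map′ (λ { (x , xs , p) → x ∷ xs , p }) (λ { (x ∷ xs , p) → x , xs , p })
       (∃? λ x → searchable-Vec ∃? n λ xs → P? (x ∷ xs))

lists≤ : ∀ {A : Set} → ℕ → List A → List (List A)
lists≤ zero    xs = [] ∷ []
lists≤ (suc n) xs = [] ∷ concatMap (λ x → map (x ∷_) (lists≤ n xs)) xs

module Matrices (ℓ : ℕ) .{{_ : NonZero ℓ}} where
  open Field ℓ public

  _≟V_ : DecidableEquality V2
  vec a b ≟V vec c d =
    map′ (λ { (refl , refl) → refl }) (λ { refl → refl , refl }) ((a F.≟ c) ×-dec (b F.≟ d))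

  _≟M_ : DecidableEquality M2
  mat a b c d ≟M mat a′ b′ c′ d′ =
    map′ (λ { (refl , refl , refl , refl) → refl }) (λ { refl → refl , refl , refl , refl })
         ((a F.≟ a′) ×-dec (b F.≟ b′) ×-dec (c F.≟ c′) ×-dec (d F.≟ d′))

  searchable-V2 : Searchable V2
  searchable-V2 P? =
    map′ (λ { (x , y , p) → vec x y , p }) (λ { (vec x y , p) → x , y , p })
         (any? λ x → any? λ y → P? (vec x y))

  searchable-M2 : Searchable M2
  searchable-M2 P? =
    map′ (λ { (a , b , c , d , p) → mat a b c d , p }) (λ { (mat a b c d , p) → a , b , c , d , p })
         (any? λ a → any? λ b → any? λ c → any? λ d → P? (mat a b c d))

  ∀V2? : Exhaustible V2
  ∀V2? = searchable⇒exhaustible searchable-V2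

  ∀M2? : Exhaustible M2
  ∀M2? = searchable⇒exhaustible searchable-M2

  InGL2? : Decidable InGL2
  InGL2? g = ¬? (det g F.≟ 0F)

  Ker? : ∀ A → Decidable (Ker A)
  Ker? A v = apply A v ≟V 0V

  LinIndep? : ∀ {n} (vs : Vec V2 n) → Dec (LinIndep vs)
  LinIndep? {n} vs = searchable⇒exhaustible (searchable-Vec any? n) λ cs →
    (lincomb cs vs ≟V 0V) →-dec AllV.all? (F._≟ 0F) cs

  IsKerBasis? : ∀ {n} A (vs : Vec V2 n) → Dec (IsKerBasis A vs)
  IsKerBasis? {n} A vs =
    AllV.all? (Ker? A) vs ×-dec LinIndep? vs ×-dec
    ∀V2? λ w → Ker? A w →-dec searchable-Vec any? n λ cs → lincomb cs vs ≟V w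

  Dim₁? : ∀ g n → Dec (Dim₁ g n)
  Dim₁? g n = searchable-Vec searchable-V2 n (IsKerBasis? (g -M I2))

  τ σ : M2
  τ = mat 1F 1F 0F 1F
  σ = mat 0F 1F 1F 0F

  _^F_ : 𝔽 → ℕ → 𝔽
  a ^F zero  = 1F
  a ^F suc n = a *F (a ^F n)

  _^M_ : M2 → ℕ → M2
  g ^M zero  = I2
  g ^M suc n = g *M (g ^M n)

  -- The adjugate scaled by det g ^ (ℓ - 2), which inverts det g by Fermat's
  -- little theorem when ℓ is prime.
  inverse : M2 → M2
  inverse g@(mat a b c d) = mat (e *F d) (e *F (0F -F b)) (e *F (0F -F c)) (e *F a)
    where e = det g ^F (ℓ ∸ 2)

  conjugate : M2 → M2 → M2
  conjugate x h = x *M (h *M inverse x)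

  conjugate-product : M2 → List M2 → M2
  conjugate-product h []       = I2
  conjugate-product h (x ∷ xs) = conjugate x h *M conjugate-product h xs

  IsConjugateProduct : M2 → M2 → List M2 → Set
  IsConjugateProduct h t xs = AllL InGL2 xs × conjugate-product h xs ≡ t

  ProductOfConjugates : M2 → M2 → Set
  ProductOfConjugates h t = ∃ (IsConjugateProduct h t)

  IsConjugateProduct? : ∀ h t → Decidable (IsConjugateProduct h t)
  IsConjugateProduct? h t xs = AllL.all? InGL2? xs ×-dec (conjugate-product h xs ≟M t)

  GL₂ : List M2
  GL₂ = filter InGL2? (concatMap (λ a → concatMap (λ b → concatMap (λ c →
          map (mat a b c) (allFin ℓ)) (allFin ℓ)) (allFin ℓ)) (allFin ℓ))

module Decisions (ℓ : ℕ) .{{_ : NonZero ℓ}} where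
  open Matrices ℓ

  *M-identityˡ? : Dec (∀ a → I2 *M a ≡ a)
  *M-identityˡ? = ∀M2? λ a → (I2 *M a) ≟M a

  *M-identityʳ? : Dec (∀ a → a *M I2 ≡ a)
  *M-identityʳ? = ∀M2? λ a → (a *M I2) ≟M a

  inverseʳ-unique? : Dec (∀ x y → x *M y ≡ I2 → y ≡ inverse x)
  inverseʳ-unique? = ∀M2? λ x → ∀M2? λ y → ((x *M y) ≟M I2) →-dec (y ≟M inverse x)

  *M-inverse-cancelˡ? : Dec (∀ x y → InGL2 x → x *M (inverse x *M y) ≡ y)
  *M-inverse-cancelˡ? = ∀M2? λ x → ∀M2? λ y → InGL2? x →-dec ((x *M (inverse x *M y)) ≟M y)

  det-inverse-*M? : Dec (∀ x y → InGL2 x → det x ≡ det y → det (inverse x *M y) ≡ 1F)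
  det-inverse-*M? = ∀M2? λ x → ∀M2? λ y →
    InGL2? x →-dec ((det x F.≟ det y) →-dec (det (inverse x *M y) F.≟ 1F))

  Dim₁-2⇒≡I2? : Dec (∀ g → Dim₁ g 2 → g ≡ I2)
  Dim₁-2⇒≡I2? = ∀M2? λ g → Dim₁? g 2 →-dec (g ≟M I2)

  Dim₁-I2? : Dec (Dim₁ I2 2)
  Dim₁-I2? = Dim₁? I2 2

  Dim₁-τ? : Dec (Dim₁ τ 1)
  Dim₁-τ? = Dim₁? τ 1

  I2,τ∈Δ2? : Dec (InΔ2 (I2 , τ))
  I2,τ∈Δ2? = InGL2? I2 ×-dec InGL2? τ ×-dec (det I2 F.≟ det τ)

  τ-conjugate-product? : Dec (∀ h → InGL2 h → Dim₁ h 1 → Any (IsConjugateProduct h τ) (lists≤ 2 GL₂))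
  τ-conjugate-product? = ∀M2? λ h → InGL2? h →-dec (Dim₁? h 1 →-dec
    Any.any? (IsConjugateProduct? h τ) (lists≤ 2 GL₂))

  SL₂-conjugate-product? : Dec (∀ g → det g ≡ 1F → Any (IsConjugateProduct τ g) (lists≤ 5 (I2 ∷ σ ∷ [])))
  SL₂-conjugate-product? = ∀M2? λ g → (det g F.≟ 1F) →-dec
    Any.any? (IsConjugateProduct? τ g) (lists≤ 5 (I2 ∷ σ ∷ []))

data Small : ℕ → Set where
  𝔽₂ : Small 2
  𝔽₃ : Small 3

by-exhaustion : {P : (ℓ : ℕ) .{{_ : NonZero ℓ}} → Set} (P? : (ℓ : ℕ) .{{_ : NonZero ℓ}} → Dec (P ℓ)) →
  {_ : True (P? 2)} {_ : True (P? 3)} → ∀ {ℓ} .{{_ : NonZero ℓ}} → Small ℓ → P ℓ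
by-exhaustion P? {p₂} 𝔽₂ = toWitness p₂
by-exhaustion P? {_} {p₃} 𝔽₃ = toWitness p₃

module SmallField {ℓ : ℕ} .{{_ : NonZero ℓ}} (small : Small ℓ) where
  open Matrices ℓ

  *M-identityˡ : ∀ a → I2 *M a ≡ a
  *M-identityˡ = by-exhaustion Decisions.*M-identityˡ? small

  *M-identityʳ : ∀ a → a *M I2 ≡ a
  *M-identityʳ = by-exhaustion Decisions.*M-identityʳ? small

  inverseʳ-unique : ∀ x y → x *M y ≡ I2 → y ≡ inverse x
  inverseʳ-unique = by-exhaustion Decisions.inverseʳ-unique? small

  *M-inverse-cancelˡ : ∀ x y → InGL2 x → x *M (inverse x *M y) ≡ y
  *M-inverse-cancelˡ = by-exhaustion Decisions.*M-inverse-cancelˡ? small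

  det-inverse-*M : ∀ x y → InGL2 x → det x ≡ det y → det (inverse x *M y) ≡ 1F
  det-inverse-*M = by-exhaustion Decisions.det-inverse-*M? small

  Dim₁-2⇒≡I2 : ∀ g → Dim₁ g 2 → g ≡ I2
  Dim₁-2⇒≡I2 = by-exhaustion Decisions.Dim₁-2⇒≡I2? small

  Dim₁-I2 : Dim₁ I2 2
  Dim₁-I2 = by-exhaustion Decisions.Dim₁-I2? small

  Dim₁-τ : Dim₁ τ 1
  Dim₁-τ = by-exhaustion Decisions.Dim₁-τ? small

  I2,τ∈Δ2 : InΔ2 (I2 , τ)
  I2,τ∈Δ2 = by-exhaustion Decisions.I2,τ∈Δ2? small

  τ-product-of-conjugates : ∀ h → InGL2 h → Dim₁ h 1 → ProductOfConjugates h τ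
  τ-product-of-conjugates h h∈GL₂ h-dim =
    satisfied (by-exhaustion Decisions.τ-conjugate-product? small h h∈GL₂ h-dim)

  SL₂-products-of-conjugates-of-τ : ∀ g → det g ≡ 1F → ProductOfConjugates τ g
  SL₂-products-of-conjugates-of-τ g det≡1 =
    satisfied (by-exhaustion Decisions.SL₂-conjugate-product? small g det≡1)

module Subgroup {ℓ : ℕ} .{{_ : NonZero ℓ}} (small : Small ℓ) {G : Field.M2² ℓ → Set}
  (G≤Δ₂ : Field.IsSubgroupΔ2 ℓ G) (pr₁-onto : Field.Pr1Surj ℓ G) (pr₂-onto : Field.Pr2Surj ℓ G) where
  open Matrices ℓ
  open SmallField small
  open IsSubgroupΔ2 G≤Δ₂

  InKernel : M2 → Set
  InKernel h = G (I2 , h)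

  InKernel-*M : ∀ {a b} → InKernel a → InKernel b → InKernel (a *M b)
  InKernel-*M {a} {b} a∈N b∈N =
    subst (λ x → G (x , a *M b)) (*M-identityˡ I2) (mul (I2 , a) (I2 , b) a∈N b∈N)

  InKernel-conjugate : ∀ {h} x → InGL2 x → InKernel h → InKernel (conjugate x h)
  InKernel-conjugate {h} x x∈GL₂ h∈N =
    let (y , yx∈G) = pr₂-onto x x∈GL₂
        ((y′ , x′) , y′x′∈G , yx·y′x′≡1 , _) = inv (y , x) yx∈G
        y·1·y′≡1 = trans (cong (y *M_) (*M-identityˡ y′)) (cong proj₁ yx·y′x′≡1)
        x′≡x⁻¹ = inverseʳ-unique x x′ (cong proj₂ yx·y′x′≡1)
    in subst G (cong₂ _,_ y·1·y′≡1 (cong (λ z → x *M (h *M z)) x′≡x⁻¹))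
         (mul (y , x) _ yx∈G (mul (I2 , h) (y′ , x′) h∈N y′x′∈G))

  InKernel-conjugate-product : ∀ {h xs} → AllL InGL2 xs → InKernel h → InKernel (conjugate-product h xs)
  InKernel-conjugate-product []                                h∈N = one
  InKernel-conjugate-product {xs = x ∷ _} (x∈GL₂ ∷ xs∈GL₂) h∈N =
    InKernel-*M (InKernel-conjugate x x∈GL₂ h∈N) (InKernel-conjugate-product xs∈GL₂ h∈N)

  InKernel-product-of-conjugates : ∀ {h t} → ProductOfConjugates h t → InKernel h → InKernel t
  InKernel-product-of-conjugates (xs , xs∈GL₂ , refl) = InKernel-conjugate-product xs∈GL₂

  SL₂⊆kernel⇒Δ₂⊆G : (∀ g → det g ≡ 1F → InKernel g) → EqualsΔ2 G
  SL₂⊆kernel⇒Δ₂⊆G SL₂⊆N (a , b) (a∈GL₂ , _ , deta≡detb) =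
    let (b′ , ab′∈G) = pr₁-onto a a∈GL₂
        (_ , b′∈GL₂ , deta≡detb′) = ⊆Δ2 (a , b′) ab′∈G
        detb′≡detb = trans (sym deta≡detb′) deta≡detb
        b′⁻¹b∈N = SL₂⊆N (inverse b′ *M b) (det-inverse-*M b′ b b′∈GL₂ detb′≡detb)
    in subst G (cong₂ _,_ (*M-identityʳ a) (*M-inverse-cancelˡ b′ b b′∈GL₂))
         (mul (a , b′) (I2 , inverse b′ *M b) ab′∈G b′⁻¹b∈N)

  Dim₁-1-in-kernel⇒Δ₂⊆G : ∀ {h} → InKernel h → Dim₁ h 1 → EqualsΔ2 G
  Dim₁-1-in-kernel⇒Δ₂⊆G {h} h∈N h-dim =
    SL₂⊆kernel⇒Δ₂⊆G λ g det≡1 →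
      InKernel-product-of-conjugates (SL₂-products-of-conjugates-of-τ g det≡1)
        (InKernel-product-of-conjugates (τ-product-of-conjugates h h∈GL₂ h-dim) h∈N)
    where h∈GL₂ = proj₁ (proj₂ (⊆Δ2 (I2 , h) h∈N))

  ^M-closed : ∀ {a b} → G (a , b) → ∀ n → G (a ^M n , b ^M n)
  ^M-closed ab∈G zero    = one
  ^M-closed ab∈G (suc n) = mul _ _ ab∈G (^M-closed ab∈G n)

module Dimensions (ℓ : ℕ) .{{_ : NonZero ℓ}} where
  open Matrices ℓ

  Dims⇒Δ₂⊆G : ℕ → ℕ → Set₁
  Dims⇒Δ₂⊆G d₁ d₂ = ∀ {G} → IsSubgroupΔ2 G → Pr1Surj G → Pr2Surj G →
    ∀ {g₁ g₂} → G (g₁ , g₂) → Dim₁ g₁ d₁ → Dim₁ g₂ d₂ → EqualsΔ2 G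

  swap-IsSubgroupΔ2 : ∀ {G} → IsSubgroupΔ2 G → IsSubgroupΔ2 (G ∘ swap)
  swap-IsSubgroupΔ2 G≤Δ₂ = record
    { ⊆Δ2 = λ { (a , b) ba∈G → let (b∈GL₂ , a∈GL₂ , detb≡deta) = ⊆Δ2 (b , a) ba∈G
                              in a∈GL₂ , b∈GL₂ , sym detb≡deta }
    ; one = one
    ; mul = λ g h → mul (swap g) (swap h)
    ; inv = λ g g∈G → let (h , h∈G , gh≡1 , hg≡1) = inv (swap g) g∈G
                      in swap h , h∈G , cong swap gh≡1 , cong swap hg≡1
    }
    where open IsSubgroupΔ2 G≤Δ₂

  Dims⇒Δ₂⊆G-swap : ∀ {d₁ d₂} → Dims⇒Δ₂⊆G d₁ d₂ → Dims⇒Δ₂⊆G d₂ d₁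
  Dims⇒Δ₂⊆G-swap Δ₂⊆G G≤Δ₂ pr₁-onto pr₂-onto g∈G g₁-dim g₂-dim (a , b) (a∈GL₂ , b∈GL₂ , deta≡detb) =
    Δ₂⊆G (swap-IsSubgroupΔ2 G≤Δ₂) pr₂-onto pr₁-onto g∈G g₂-dim g₁-dim (b , a) (b∈GL₂ , a∈GL₂ , sym deta≡detb)

open Dimensions using (Dims⇒Δ₂⊆G; Dims⇒Δ₂⊆G-swap)

Dims-2-1⇒Δ₂⊆G : ∀ {ℓ} .{{_ : NonZero ℓ}} → Small ℓ → Dims⇒Δ₂⊆G ℓ 2 1
Dims-2-1⇒Δ₂⊆G small {G} G≤Δ₂ pr₁-onto pr₂-onto {g₁} {g₂} g∈G g₁-dim g₂-dim =
  Subgroup.Dim₁-1-in-kernel⇒Δ₂⊆G small G≤Δ₂ pr₁-onto pr₂-onto {g₂}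
    (subst (λ x → G (x , g₂)) (SmallField.Dim₁-2⇒≡I2 small g₁ g₁-dim) g∈G) g₂-dim

module _ where
  open Matrices 2

  Dim₁-0⇒cube≡I2 : ∀ g → InGL2 g → Dim₁ g 0 → g ^M 3 ≡ I2
  Dim₁-0⇒cube≡I2 = from-yes (∀M2? λ g → InGL2? g →-dec (Dim₁? g 0 →-dec ((g ^M 3) ≟M I2)))

  Dim₁-1⇒cube≡self : ∀ g → Dim₁ g 1 → g ^M 3 ≡ g
  Dim₁-1⇒cube≡self = from-yes (∀M2? λ g → Dim₁? g 1 →-dec ((g ^M 3) ≟M g))

  Dims-0-1⇒Δ₂⊆G : Dims⇒Δ₂⊆G 2 0 1
  Dims-0-1⇒Δ₂⊆G {G} G≤Δ₂ pr₁-onto pr₂-onto {g₁} {g₂} g∈G g₁-dim g₂-dim =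
    Dim₁-1-in-kernel⇒Δ₂⊆G {g₂} g³∈N g₂-dim
    where
      open Subgroup 𝔽₂ G≤Δ₂ pr₁-onto pr₂-onto
      g₁∈GL₂ : InGL2 g₁
      g₁∈GL₂ = proj₁ (IsSubgroupΔ2.⊆Δ2 G≤Δ₂ _ g∈G)
      g³∈N : InKernel g₂
      g³∈N = subst G (cong₂ _,_ (Dim₁-0⇒cube≡I2 g₁ g₁∈GL₂ g₁-dim) (Dim₁-1⇒cube≡self g₂ g₂-dim))
               (^M-closed g∈G 3)

Allowed⇒Δ₂⊆G : ∀ {ℓ} .{{_ : NonZero ℓ}} → Small ℓ → ∀ {d₁ d₂} → Allowed ℓ d₁ d₂ → Dims⇒Δ₂⊆G ℓ d₁ d₂
Allowed⇒Δ₂⊆G 𝔽₂ (inj₁ (_ , inj₁ (refl , refl)))                = Dims-0-1⇒Δ₂⊆G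
Allowed⇒Δ₂⊆G 𝔽₂ (inj₁ (_ , inj₂ (inj₁ (refl , refl))))         = Dims⇒Δ₂⊆G-swap 2 Dims-0-1⇒Δ₂⊆G
Allowed⇒Δ₂⊆G 𝔽₂ (inj₁ (_ , inj₂ (inj₂ (inj₁ (refl , refl))))) = Dims⇒Δ₂⊆G-swap 2 (Dims-2-1⇒Δ₂⊆G 𝔽₂)
Allowed⇒Δ₂⊆G 𝔽₂ (inj₁ (_ , inj₂ (inj₂ (inj₂ (refl , refl))))) = Dims-2-1⇒Δ₂⊆G 𝔽₂
Allowed⇒Δ₂⊆G 𝔽₂ (inj₂ (() , _))
Allowed⇒Δ₂⊆G 𝔽₃ (inj₁ (() , _))
Allowed⇒Δ₂⊆G 𝔽₃ (inj₂ (_ , inj₁ (refl , refl)))                = Dims⇒Δ₂⊆G-swap 3 (Dims-2-1⇒Δ₂⊆G 𝔽₃)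
Allowed⇒Δ₂⊆G 𝔽₃ (inj₂ (_ , inj₂ (refl , refl)))                = Dims-2-1⇒Δ₂⊆G 𝔽₃

Allowed-2-1 : ∀ {ℓ} → Small ℓ → Allowed ℓ 2 1
Allowed-2-1 𝔽₂ = inj₁ (refl , inj₂ (inj₂ (inj₂ (refl , refl))))
Allowed-2-1 𝔽₃ = inj₂ (refl , inj₂ (refl , refl))

small : ∀ {ℓ} → ℓ ≡ 2 ⊎ ℓ ≡ 3 → Small ℓ
small (inj₁ refl) = 𝔽₂
small (inj₂ refl) = 𝔽₃

lemma6p1 : (ℓ : ℕ) .{{_ : NonZero ℓ}} → (ℓ ≡ 2 ⊎ ℓ ≡ 3)
    → (G : Field.M2² ℓ → Set) → Field.IsSubgroupΔ2 ℓ G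
    → Field.Pr1Surj ℓ G → Field.Pr2Surj ℓ G
    → (Field.EqualsΔ2 ℓ G
       ⇔ Σ (Field.M2² ℓ) (λ g → G g × Σ ℕ (λ d₁ → Σ ℕ (λ d₂ →
           Field.Dim₁ ℓ (proj₁ g) d₁ × Field.Dim₁ ℓ (proj₂ g) d₂ × Allowed ℓ d₁ d₂))))
lemma6p1 ℓ ℓ≡2⊎ℓ≡3 G G≤Δ₂ pr₁-onto pr₂-onto = mk⇔
  (λ G=Δ₂ → (I2 , τ) , G=Δ₂ _ I2,τ∈Δ2 , 2 , 1 , Dim₁-I2 , Dim₁-τ , Allowed-2-1 ℓ-small)
  (λ { (_ , g∈G , _ , _ , g₁-dim , g₂-dim , allowed) →
         Allowed⇒Δ₂⊆G ℓ-small allowed G≤Δ₂ pr₁-onto pr₂-onto g∈G g₁-dim g₂-dim })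
  where
    ℓ-small = small ℓ≡2⊎ℓ≡3
    open Matrices ℓ
    open SmallField ℓ-small
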